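{- For all term types $\delta,\delta'$, stack types $\kappa$, terms $M,N$ and stacks $\vec N,\vec P$: (1) if $M[N/x]\vec P\in[\![\delta]\!]$ and $N\in[\![\delta']\!]$, then $(\lambda x.M)N\vec P\in[\![\delta]\!]$; (2) if $(\mu\alpha.(([\beta]M)[\alpha\Leftarrow\vec N]))\vec P\in[\![\delta]\!]$ and $\vec N\in[\![\kappa]\!]$, then $(\mu\alpha.[\beta]M)\vec N\vec P\in[\![\delta]\!]$; (3) if $(\mu\alpha.[\alpha](M[\alpha\Leftarrow\vec N])\vec N)\vec P\in[\![\delta]\!]$, then $(\mu\alpha.[\alpha]M)\vec N\vec P\in[\![\delta]\!]$.
   Context: Pure $\lambda\mu$-calculus: terms $M,N ::= x \mid \lambda x.M \mid MN \mid \mu\alpha.C$, commands $C ::= [\alpha]M$; $\lambda$ binds $x$, $\mu$ binds $\alpha$. A stack is a finite (possibly empty) sequence $\vec L=L_1{:}\cdots{:}L_k$ of terms, $M\vec L=ML_1\cdots L_k$, $N{:}\vec L$ is the stack with $N$ prepended. Structural substitution $T[\alpha\Leftarrow L]$ replaces every subcommand $[\alpha]P$ of $T$ by $[\alpha](P[\alpha\Leftarrow L])L$ and commutes with other constructs; for $\vec L=L_1{:}\cdots{:}L_k$ with $\alpha$ not in the $L_i$, $T[\alpha\Leftarrow\vec L]=T[\alpha\Leftarrow L_1]\cdots[\alpha\Leftarrow L_k]$. Reduction is the compatible closure of $(\lambda x.M)N\to M[N/x]$ and $(\mu\beta.C)N\to\mu\beta.(C[\beta\Leftarrow N])$. $\mathcal{SN}$: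 strongly normalising terms; $\mathcal{SN}^*$: finite stacks of terms in $\mathcal{SN}$. Types: with a single constant $\nu$ and a symbol $\omega$ (not itself a type), term types $\delta ::= \nu \mid \omega\to\nu \mid \kappa\to\nu \mid \delta\wedge\delta$ and stack types $\kappa ::= \delta\times\omega \mid \delta\times\kappa \mid \kappa\wedge\kappa$. Interpretation: $[\![\nu]\!]=[\![\omega\to\nu]\!]=\mathcal{SN}$; $[\![\kappa\to\nu]\!]=\{M\mid \forall\vec L\in[\![\kappa]\!],\ M\vec L\in\mathcal{SN}\}$; $[\![\delta\times\omega]\!]=\{N{:}\vec L\mid N\in[\![\delta]\!],\vec L\in\mathcal{SN}^*\}$; $[\![\delta\times\kappa]\!]=\{N{:}\vec L\mid N\in[\![\delta]\!],\vec L\in[\![\kappa]\!]\}$; $[\![\sigma\wedge\tau]\!]=[\![\sigma]\!]\cap[\![\tau]\!]$. -}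

module Defs where

open import Data.Nat using (ℕ; zero; suc; _+_; _<ᵇ_; _≡ᵇ_; compare; less; equal; greater)
open import Data.Bool using (if_then_else_)
open import Data.List using (List; []; _∷_; foldl)
open import Data.List.Relation.Unary.All using (All)
open import Data.Product using (_×_)
open import Data.Empty using (⊥)

-- Pure λμ-syntax with de Bruijn indices.
-- Two independent index spaces: term variables (bound by lam) and
-- names / μ-variables (bound by mu).

mutual
  data Term : Set where
    var : ℕ → Term
    lam : Term → Term
    app : Term → Term → Term
    mu  : Cmd → Term

  data Cmd : Set where
    named : ℕ → Term → Cmd

Stack : Set
Stack = List Term

_·*_ : Term → Stack → Term
M ·* Ls = foldl app M Ls

mutual
  shiftT : ℕ → Term → Term
  shiftT c (var n)   = if n <ᵇ c then var n else var (suc n)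
  shiftT c (lam M)   = lam (shiftT (suc c) M)
  shiftT c (app M N) = app (shiftT c M) (shiftT c N)
  shiftT c (mu C)    = mu (shiftTC c C)

  shiftTC : ℕ → Cmd → Cmd
  shiftTC c (named a M) = named a (shiftT c M)

mutual
  shiftN : ℕ → Term → Term
  shiftN c (var n)   = var n
  shiftN c (lam M)   = lam (shiftN c M)
  shiftN c (app M N) = app (shiftN c M) (shiftN c N)
  shiftN c (mu C)    = mu (shiftNC (suc c) C)

  shiftNC : ℕ → Cmd → Cmd
  shiftNC c (named a M) = named (if a <ᵇ c then a else suc a) (shiftN c M)

-- Capture-avoiding substitution M[N/k] of N for term variable k
-- (variables above k are decremented, as k's binder disappears)

substVar : ℕ → Term → ℕ → Term
substVar k N n with compare n k
... | less _ _      = var n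
... | equal _       = N
... | greater m j   = var (m + j)

mutual
  substT : ℕ → Term → Term → Term
  substT k N (var n)   = substVar k N n
  substT k N (lam M)   = lam (substT (suc k) (shiftT 0 N) M)
  substT k N (app M P) = app (substT k N M) (substT k N P)
  substT k N (mu C)    = mu (substTC k (shiftN 0 N) C)

  substTC : ℕ → Term → Cmd → Cmd
  substTC k N (named a M) = named a (substT k N M)

_[_/0] : Term → Term → Term
M [ N /0] = substT 0 N M

-- Structural substitution T[α ⇐ L]: every subcommand [α]P becomes
-- [α](P[α ⇐ L]) L.  The name α stays bound.

mutual
  ssubst : ℕ → Term → Term → Term
  ssubst a L (var n)   = var n
  ssubst a L (lam M)   = lam (ssubst a (shiftT 0 L) M)
  ssubst a L (app M P) = app (ssubst a L M) (ssubst a L P)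
  ssubst a L (mu C)    = mu (ssubstC (suc a) (shiftN 0 L) C)

  ssubstC : ℕ → Term → Cmd → Cmd
  ssubstC a L (named b P) =
    if b ≡ᵇ a then named b (app (ssubst a L P) L)
              else named b (ssubst a L P)

ssubst* : ℕ → Stack → Term → Term
ssubst* a Ls T = foldl (λ T' L → ssubst a L T') T Ls

ssubstC* : ℕ → Stack → Cmd → Cmd
ssubstC* a Ls C = foldl (λ C' L → ssubstC a L C') C Ls

-- weakening a stack by one name (to move it under a μ-binder)
shiftN* : Stack → Stack
shiftN* = Data.List.map (shiftN 0)
  where import Data.List

mutual
  data _⟶_ : Term → Term → Set where
    βstep : ∀ {M N} → app (lam M) N ⟶ (M [ N /0])
    μstep : ∀ {C N} → app (mu C) N ⟶ mu (ssubstC 0 (shiftN 0 N) C)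
    lamc  : ∀ {M M'} → M ⟶ M' → lam M ⟶ lam M'
    appl  : ∀ {M M' N} → M ⟶ M' → app M N ⟶ app M' N
    appr  : ∀ {M N N'} → N ⟶ N' → app M N ⟶ app M N'
    muc   : ∀ {C C'} → C ⟶ᶜ C' → mu C ⟶ mu C'

  data _⟶ᶜ_ : Cmd → Cmd → Set where
    namedc : ∀ {a M M'} → M ⟶ M' → named a M ⟶ᶜ named a M'

data SN (M : Term) : Set where
  sn : (∀ {M'} → M ⟶ M' → SN M') → SN M

SN* : Stack → Set
SN* = All SN

mutual
  data TType : Set where
    ν    : TType
    ω⇒ν  : TType
    _⇒ν  : SType → TType
    _∧ᵗ_ : TType → TType → TType

  data SType : Set where
    _×ω  : TType → SType
    _×ˢ_ : TType → SType → SType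
    _∧ˢ_ : SType → SType → SType

mutual
  ⟦_⟧ : TType → Term → Set
  ⟦ ν ⟧ M        = SN M
  ⟦ ω⇒ν ⟧ M      = SN M
  ⟦ κ ⇒ν ⟧ M     = ∀ (Ls : Stack) → ⟦ κ ⟧ˢ Ls → SN (M ·* Ls)
  ⟦ δ ∧ᵗ δ' ⟧ M  = ⟦ δ ⟧ M × ⟦ δ' ⟧ M

  ⟦_⟧ˢ : SType → Stack → Set
  ⟦ δ ×ω ⟧ˢ []        = ⊥
  ⟦ δ ×ω ⟧ˢ (N ∷ Ls)  = ⟦ δ ⟧ N × SN* Ls
  ⟦ δ ×ˢ κ ⟧ˢ []      = ⊥
  ⟦ δ ×ˢ κ ⟧ˢ (N ∷ Ls) = ⟦ δ ⟧ N × ⟦ κ ⟧ˢ Ls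
  ⟦ κ ∧ˢ κ' ⟧ˢ Ls     = ⟦ κ ⟧ˢ Ls × ⟦ κ' ⟧ˢ Ls

module Submission where

-- Each clause says that some ⟦δ⟧ is closed under a head expansion. Membership of A in ⟦δ⟧ depends only on
-- strong normalisation of the terms A L⃗ for the stacks L⃗ of some class, so it suffices that SN is closed,
-- in every stack context, under β-expansion M[N/x] ↦ (λx.M) N for N ∈ SN and under μ-expansion
-- μα.(C[α⇐N⃗]) ↦ (μα.C) N⃗ for N⃗ ∈ SN*. Both follow by induction on the SN premises: a one-step reduct of
-- the expanded term is either the contractum itself or an expansion of a reduct of the premise, the
-- latter because reduction is stable under substitution and structural substitution. The hypotheses
-- N ∈ ⟦δ'⟧ and N⃗ ∈ ⟦κ⟧ are used only through ⟦δ'⟧ ⊆ SN and ⟦κ⟧ ⊆ SN*, which hold since variables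
-- inhabit every type. For (3), N⃗ does not mention α, so [α](M[α⇐N⃗]) N⃗ = ([α]M)[α⇐N⃗] and (3) becomes
-- (2), with N⃗ ∈ SN* read off the hypothesis itself.

open import Defs
open import Data.Nat using (ℕ)
open import Data.Product using (_×_)

open import Data.Bool using (true; false; T; if_then_else_)
open import Data.Bool.Properties using (if-float)
open import Data.Empty using (⊥-elim)
open import Data.List using (List; []; _∷_; [_]; _++_; length; map; replicate)
open import Data.List.Properties using (foldl-++; map-++; ++-assoc; ++-identityʳ)
open import Data.List.Relation.Unary.All using ([]; _∷_)
import Data.List.Relation.Unary.All as All
open import Data.Nat
open import Data.Nat.Properties
open import Data.Product using (∃; _,_)
open import Data.Sum using (_⊎_; inj₁; inj₂)
open import Function using (_∘_)
open import Relation.Binary.Construct.Closure.ReflexiveTransitive using (Star; ε; _◅_; _◅◅_; gmap)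
open import Relation.Binary.Definitions using (tri<; tri≈; tri>)
open import Relation.Binary.PropositionalEquality hiding ([_])
open import Relation.Nullary using (yes; no)
open ≡-Reasoning

shiftIdx : ℕ → ℕ → ℕ
shiftIdx c a = if a <ᵇ c then a else suc a

shiftIdx-< : ∀ {c a} → a < c → shiftIdx c a ≡ a
shiftIdx-< {c} {a} a<c with a <ᵇ c | <⇒<ᵇ a<c
... | true | _ = refl

shiftIdx-≥ : ∀ {c a} → c ≤ a → shiftIdx c a ≡ suc a
shiftIdx-≥ {c} {a} c≤a with a <ᵇ c in eq
... | true  = ⊥-elim (<⇒≱ (<ᵇ⇒< a c (subst T (sym eq) _)) c≤a)
... | false = refl

shiftIdx-suc : ∀ c a → shiftIdx (suc c) (suc a) ≡ suc (shiftIdx c a)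
shiftIdx-suc c a = sym (if-float suc (a <ᵇ c))

shiftIdx-comm : ∀ {c d} a → c ≤ d → shiftIdx (suc d) (shiftIdx c a) ≡ shiftIdx c (shiftIdx d a)
shiftIdx-comm {c} {d} a c≤d with a <? c | a <? d
... | yes a<c | _ = let a<d = <-≤-trans a<c c≤d in begin
  shiftIdx (suc d) (shiftIdx c a) ≡⟨ cong (shiftIdx (suc d)) (shiftIdx-< a<c) ⟩
  shiftIdx (suc d) a              ≡⟨ shiftIdx-< (m<n⇒m<1+n a<d) ⟩
  a                               ≡⟨ sym (shiftIdx-< a<c) ⟩
  shiftIdx c a                    ≡⟨ cong (shiftIdx c) (sym (shiftIdx-< a<d)) ⟩
  shiftIdx c (shiftIdx d a)       ∎
... | no a≮c | yes a<d = begin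
  shiftIdx (suc d) (shiftIdx c a) ≡⟨ cong (shiftIdx (suc d)) (shiftIdx-≥ (≮⇒≥ a≮c)) ⟩
  shiftIdx (suc d) (suc a)        ≡⟨ shiftIdx-< (s≤s a<d) ⟩
  suc a                           ≡⟨ sym (shiftIdx-≥ (≮⇒≥ a≮c)) ⟩
  shiftIdx c a                    ≡⟨ cong (shiftIdx c) (sym (shiftIdx-< a<d)) ⟩
  shiftIdx c (shiftIdx d a)       ∎
... | no a≮c | no a≮d = begin
  shiftIdx (suc d) (shiftIdx c a) ≡⟨ cong (shiftIdx (suc d)) (shiftIdx-≥ (≮⇒≥ a≮c)) ⟩
  shiftIdx (suc d) (suc a)        ≡⟨ shiftIdx-≥ (s≤s (≮⇒≥ a≮d)) ⟩
  suc (suc a)                     ≡⟨ sym (shiftIdx-≥ (m≤n⇒m≤1+n (≮⇒≥ a≮c))) ⟩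
  shiftIdx c (suc a)              ≡⟨ cong (shiftIdx c) (sym (shiftIdx-≥ (≮⇒≥ a≮d))) ⟩
  shiftIdx c (shiftIdx d a)       ∎

≤-shiftIdx : ∀ c a → a ≤ shiftIdx c a
≤-shiftIdx c a with a <? c
... | yes a<c = ≤-reflexive (sym (shiftIdx-< a<c))
... | no a≮c  = ≤-trans (n≤1+n a) (≤-reflexive (sym (shiftIdx-≥ (≮⇒≥ a≮c))))

shiftIdx-≤ : ∀ c a → shiftIdx c a ≤ suc a
shiftIdx-≤ c a with a <? c
... | yes a<c = ≤-trans (≤-reflexive (shiftIdx-< a<c)) (n≤1+n a)
... | no a≮c  = ≤-reflexive (shiftIdx-≥ (≮⇒≥ a≮c))

shiftIdx-injective : ∀ c {a b} → shiftIdx c a ≡ shiftIdx c b → a ≡ b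
shiftIdx-injective c {a} {b} eq with a <? c | b <? c
... | yes a<c | yes b<c = trans (sym (shiftIdx-< a<c)) (trans eq (shiftIdx-< b<c))
... | yes a<c | no b≮c  =
  ⊥-elim (b≮c (<-trans (n<1+n b) (subst (_< c) (trans (sym (shiftIdx-< a<c)) (trans eq (shiftIdx-≥ (≮⇒≥ b≮c)))) a<c)))
... | no a≮c  | yes b<c =
  ⊥-elim (a≮c (<-trans (n<1+n a) (subst (_< c) (trans (sym (shiftIdx-< b<c)) (trans (sym eq) (shiftIdx-≥ (≮⇒≥ a≮c)))) b<c)))
... | no a≮c  | no b≮c  = suc-injective (trans (sym (shiftIdx-≥ (≮⇒≥ a≮c))) (trans eq (shiftIdx-≥ (≮⇒≥ b≮c))))

shiftIdx≢ : ∀ c a → shiftIdx c a ≢ c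
shiftIdx≢ c a with a <? c
... | yes a<c = subst (_≢ c) (sym (shiftIdx-< a<c)) (<⇒≢ a<c)
... | no a≮c  = subst (_≢ c) (sym (shiftIdx-≥ (≮⇒≥ a≮c))) (>⇒≢ (s≤s (≮⇒≥ a≮c)))

substVar-< : ∀ {k n} N → n < k → substVar k N n ≡ var n
substVar-< {k} {n} N n<k with compare n k
... | less _ _    = refl
... | equal _     = ⊥-elim (<-irrefl refl n<k)
... | greater _ j = ⊥-elim (<-asym n<k (s≤s (m≤m+n _ j)))

substVar-≡ : ∀ k {n} N → n ≡ k → substVar k N n ≡ N
substVar-≡ k {n} N n≡k with compare n k
... | less _ j    = ⊥-elim (<-irrefl n≡k (s≤s (m≤m+n _ j)))
... | equal _     = refl
... | greater _ j = ⊥-elim (<-irrefl (sym n≡k) (s≤s (m≤m+n _ j)))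

substVar-> : ∀ {k n} N → k < n → substVar k N n ≡ var (pred n)
substVar-> {k} {n} N k<n with compare n k
... | less _ j    = ⊥-elim (<-asym k<n (s≤s (m≤m+n _ j)))
... | equal _     = ⊥-elim (<-irrefl refl k<n)
... | greater _ _ = refl

shiftT-var : ∀ c n → shiftT c (var n) ≡ var (shiftIdx c n)
shiftT-var c n = sym (if-float var (n <ᵇ c))

ssubstC-≡ : ∀ a L P → ssubstC a L (named a P) ≡ named a (app (ssubst a L P) L)
ssubstC-≡ a L P with a ≡ᵇ a | ≡⇒≡ᵇ a a refl
... | true | _ = refl

ssubstC-≢ : ∀ {a b} L P → b ≢ a → ssubstC a L (named b P) ≡ named b (ssubst a L P)
ssubstC-≢ {a} {b} L P b≢a with b ≡ᵇ a in eq
... | true  = ⊥-elim (b≢a (≡ᵇ⇒≡ b a (subst T (sym eq) _)))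
... | false = refl

-- Shifts, substitution and structural substitution commute

mutual
  shiftT-shiftT : ∀ {c d} M → c ≤ d → shiftT (suc d) (shiftT c M) ≡ shiftT c (shiftT d M)
  shiftT-shiftT {c} {d} (var n) c≤d = begin
    shiftT (suc d) (shiftT c (var n)) ≡⟨ cong (shiftT (suc d)) (shiftT-var c n) ⟩
    shiftT (suc d) (var (shiftIdx c n)) ≡⟨ shiftT-var (suc d) (shiftIdx c n) ⟩
    var (shiftIdx (suc d) (shiftIdx c n)) ≡⟨ cong var (shiftIdx-comm n c≤d) ⟩
    var (shiftIdx c (shiftIdx d n)) ≡⟨ sym (shiftT-var c (shiftIdx d n)) ⟩
    shiftT c (var (shiftIdx d n)) ≡⟨ cong (shiftT c) (sym (shiftT-var d n)) ⟩
    shiftT c (shiftT d (var n)) ∎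
  shiftT-shiftT (lam M)   c≤d = cong lam (shiftT-shiftT M (s≤s c≤d))
  shiftT-shiftT (app M N) c≤d = cong₂ app (shiftT-shiftT M c≤d) (shiftT-shiftT N c≤d)
  shiftT-shiftT (mu C)    c≤d = cong mu (shiftTC-shiftTC C c≤d)

  shiftTC-shiftTC : ∀ {c d} C → c ≤ d → shiftTC (suc d) (shiftTC c C) ≡ shiftTC c (shiftTC d C)
  shiftTC-shiftTC (named a M) c≤d = cong (named a) (shiftT-shiftT M c≤d)

mutual
  shiftN-shiftN : ∀ {c d} M → c ≤ d → shiftN (suc d) (shiftN c M) ≡ shiftN c (shiftN d M)
  shiftN-shiftN (var n)   c≤d = refl
  shiftN-shiftN (lam M)   c≤d = cong lam (shiftN-shiftN M c≤d)
  shiftN-shiftN (app M N) c≤d = cong₂ app (shiftN-shiftN M c≤d) (shiftN-shiftN N c≤d)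
  shiftN-shiftN (mu C)    c≤d = cong mu (shiftNC-shiftNC C (s≤s c≤d))

  shiftNC-shiftNC : ∀ {c d} C → c ≤ d → shiftNC (suc d) (shiftNC c C) ≡ shiftNC c (shiftNC d C)
  shiftNC-shiftNC (named a M) c≤d = cong₂ named (shiftIdx-comm a c≤d) (shiftN-shiftN M c≤d)

mutual
  shiftT-shiftN : ∀ c d M → shiftT c (shiftN d M) ≡ shiftN d (shiftT c M)
  shiftT-shiftN c d (var n)   = trans (shiftT-var c n) (cong (shiftN d) (sym (shiftT-var c n)))
  shiftT-shiftN c d (lam M)   = cong lam (shiftT-shiftN (suc c) d M)
  shiftT-shiftN c d (app M N) = cong₂ app (shiftT-shiftN c d M) (shiftT-shiftN c d N)
  shiftT-shiftN c d (mu C)    = cong mu (shiftTC-shiftNC c (suc d) C)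

  shiftTC-shiftNC : ∀ c d C → shiftTC c (shiftNC d C) ≡ shiftNC d (shiftTC c C)
  shiftTC-shiftNC c d (named a M) = cong (named _) (shiftT-shiftN c d M)

mutual
  substT-shiftT : ∀ k N M → substT k N (shiftT k M) ≡ M
  substT-shiftT k N (var n) with n <? k
  ... | yes n<k = trans (cong (substT k N) (trans (shiftT-var k n) (cong var (shiftIdx-< n<k)))) (substVar-< N n<k)
  ... | no n≮k  = trans (cong (substT k N) (trans (shiftT-var k n) (cong var (shiftIdx-≥ (≮⇒≥ n≮k))))) (substVar-> N (s≤s (≮⇒≥ n≮k)))
  substT-shiftT k N (lam M)   = cong lam (substT-shiftT (suc k) (shiftT 0 N) M)
  substT-shiftT k N (app M P) = cong₂ app (substT-shiftT k N M) (substT-shiftT k N P)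
  substT-shiftT k N (mu C)    = cong mu (substTC-shiftTC k (shiftN 0 N) C)

  substTC-shiftTC : ∀ k N C → substTC k N (shiftTC k C) ≡ C
  substTC-shiftTC k N (named a M) = cong (named a) (substT-shiftT k N M)

mutual
  shiftT-substT-above : ∀ {k c} N M → k ≤ c → shiftT c (substT k N M) ≡ substT k (shiftT c N) (shiftT (suc c) M)
  shiftT-substT-above {k} {c} N (var n) k≤c with <-cmp n k
  ... | tri< n<k _ _ = begin
    shiftT c (substVar k N n)                    ≡⟨ cong (shiftT c) (substVar-< N n<k) ⟩
    shiftT c (var n)                             ≡⟨ trans (shiftT-var c n) (cong var (shiftIdx-< (<-≤-trans n<k k≤c))) ⟩
    var n                                        ≡⟨ sym (substVar-< (shiftT c N) n<k) ⟩
    substT k (shiftT c N) (var n)                ≡⟨ cong (substT k (shiftT c N)) (sym (trans (shiftT-var (suc c) n) (cong var (shiftIdx-< (<-≤-trans n<k (m≤n⇒m≤1+n k≤c)))))) ⟩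
    substT k (shiftT c N) (shiftT (suc c) (var n)) ∎
  ... | tri≈ _ refl _ = begin
    shiftT c (substVar n N n)                    ≡⟨ cong (shiftT c) (substVar-≡ n N refl) ⟩
    shiftT c N                                   ≡⟨ sym (substVar-≡ n (shiftT c N) refl) ⟩
    substT n (shiftT c N) (var n)                ≡⟨ cong (substT n (shiftT c N)) (sym (trans (shiftT-var (suc c) n) (cong var (shiftIdx-< (s≤s k≤c))))) ⟩
    substT n (shiftT c N) (shiftT (suc c) (var n)) ∎
  shiftT-substT-above {k} {c} N (var (suc m)) k≤c | tri> _ _ k<1+m = begin
    shiftT c (substVar k N (suc m))              ≡⟨ cong (shiftT c) (substVar-> N k<1+m) ⟩
    shiftT c (var m)                             ≡⟨ shiftT-var c m ⟩
    var (shiftIdx c m)                           ≡⟨ sym (substVar-> (shiftT c N) (s≤s (≤-trans (≤-pred k<1+m) (≤-shiftIdx c m)))) ⟩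
    substT k (shiftT c N) (var (suc (shiftIdx c m))) ≡⟨ cong (substT k (shiftT c N)) (sym (trans (shiftT-var (suc c) (suc m)) (cong var (shiftIdx-suc c m)))) ⟩
    substT k (shiftT c N) (shiftT (suc c) (var (suc m))) ∎
  shiftT-substT-above {k} {c} N (lam M) k≤c = cong lam (trans (shiftT-substT-above (shiftT 0 N) M (s≤s k≤c))
    (cong (λ N' → substT (suc k) N' (shiftT (suc (suc c)) M)) (shiftT-shiftT N z≤n)))
  shiftT-substT-above N (app M P) k≤c = cong₂ app (shiftT-substT-above N M k≤c) (shiftT-substT-above N P k≤c)
  shiftT-substT-above {k} {c} N (mu C) k≤c = cong mu (trans (shiftTC-substTC-above (shiftN 0 N) C k≤c)
    (cong (λ N' → substTC k N' (shiftTC (suc c) C)) (shiftT-shiftN c 0 N)))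

  shiftTC-substTC-above : ∀ {k c} N C → k ≤ c → shiftTC c (substTC k N C) ≡ substTC k (shiftT c N) (shiftTC (suc c) C)
  shiftTC-substTC-above N (named a M) k≤c = cong (named a) (shiftT-substT-above N M k≤c)

mutual
  shiftT-substT-below : ∀ {k c} N M → c ≤ k → shiftT c (substT k N M) ≡ substT (suc k) (shiftT c N) (shiftT c M)
  shiftT-substT-below {k} {c} N (var n) c≤k with <-cmp n k
  ... | tri< n<k _ _ = begin
    shiftT c (substVar k N n)                    ≡⟨ cong (shiftT c) (substVar-< N n<k) ⟩
    shiftT c (var n)                             ≡⟨ shiftT-var c n ⟩
    var (shiftIdx c n)                           ≡⟨ sym (substVar-< (shiftT c N) (≤-trans (s≤s (shiftIdx-≤ c n)) (s≤s n<k))) ⟩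
    substT (suc k) (shiftT c N) (var (shiftIdx c n)) ≡⟨ cong (substT (suc k) (shiftT c N)) (sym (shiftT-var c n)) ⟩
    substT (suc k) (shiftT c N) (shiftT c (var n)) ∎
  ... | tri≈ _ refl _ = begin
    shiftT c (substVar n N n)                    ≡⟨ cong (shiftT c) (substVar-≡ n N refl) ⟩
    shiftT c N                                   ≡⟨ sym (substVar-≡ (suc n) (shiftT c N) refl) ⟩
    substT (suc n) (shiftT c N) (var (suc n))    ≡⟨ cong (substT (suc n) (shiftT c N)) (sym (trans (shiftT-var c n) (cong var (shiftIdx-≥ c≤k)))) ⟩
    substT (suc n) (shiftT c N) (shiftT c (var n)) ∎
  shiftT-substT-below {k} {c} N (var (suc m)) c≤k | tri> _ _ k<1+m = begin
    shiftT c (substVar k N (suc m))              ≡⟨ cong (shiftT c) (substVar-> N k<1+m) ⟩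
    shiftT c (var m)                             ≡⟨ trans (shiftT-var c m) (cong var (shiftIdx-≥ (≤-trans c≤k (≤-pred k<1+m)))) ⟩
    var (suc m)                                  ≡⟨ sym (substVar-> (shiftT c N) (s≤s k<1+m)) ⟩
    substT (suc k) (shiftT c N) (var (suc (suc m))) ≡⟨ cong (substT (suc k) (shiftT c N)) (sym (trans (shiftT-var c (suc m)) (cong var (shiftIdx-≥ (≤-trans c≤k (<⇒≤ k<1+m)))))) ⟩
    substT (suc k) (shiftT c N) (shiftT c (var (suc m))) ∎
  shiftT-substT-below {k} {c} N (lam M) c≤k = cong lam (trans (shiftT-substT-below (shiftT 0 N) M (s≤s c≤k))
    (cong (λ N' → substT (suc (suc k)) N' (shiftT (suc c) M)) (shiftT-shiftT N z≤n)))
  shiftT-substT-below N (app M P) c≤k = cong₂ app (shiftT-substT-below N M c≤k) (shiftT-substT-below N P c≤k)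
  shiftT-substT-below {k} {c} N (mu C) c≤k = cong mu (trans (shiftTC-substTC-below (shiftN 0 N) C c≤k)
    (cong (λ N' → substTC (suc k) N' (shiftTC c C)) (shiftT-shiftN c 0 N)))

  shiftTC-substTC-below : ∀ {k c} N C → c ≤ k → shiftTC c (substTC k N C) ≡ substTC (suc k) (shiftT c N) (shiftTC c C)
  shiftTC-substTC-below N (named a M) c≤k = cong (named a) (shiftT-substT-below N M c≤k)

shiftN-substVar : ∀ c k N n → shiftN c (substVar k N n) ≡ substVar k (shiftN c N) n
shiftN-substVar c k N n with compare n k
... | less _ _    = refl
... | equal _     = refl
... | greater _ _ = refl

mutual
  shiftN-substT : ∀ c k N M → shiftN c (substT k N M) ≡ substT k (shiftN c N) (shiftN c M)
  shiftN-substT c k N (var n)   = shiftN-substVar c k N n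
  shiftN-substT c k N (lam M)   = cong lam (trans (shiftN-substT c (suc k) (shiftT 0 N) M)
    (cong (λ N' → substT (suc k) N' (shiftN c M)) (sym (shiftT-shiftN 0 c N))))
  shiftN-substT c k N (app M P) = cong₂ app (shiftN-substT c k N M) (shiftN-substT c k N P)
  shiftN-substT c k N (mu C)    = cong mu (trans (shiftNC-substTC (suc c) k (shiftN 0 N) C)
    (cong (λ N' → substTC k N' (shiftNC (suc c) C)) (shiftN-shiftN N z≤n)))

  shiftNC-substTC : ∀ c k N C → shiftNC c (substTC k N C) ≡ substTC k (shiftN c N) (shiftNC c C)
  shiftNC-substTC c k N (named a M) = cong (named _) (shiftN-substT c k N M)

mutual
  shiftT-ssubst : ∀ c a L M → shiftT c (ssubst a L M) ≡ ssubst a (shiftT c L) (shiftT c M)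
  shiftT-ssubst c a L (var n)   = trans (shiftT-var c n) (sym (cong (ssubst a (shiftT c L)) (shiftT-var c n)))
  shiftT-ssubst c a L (lam M)   = cong lam (trans (shiftT-ssubst (suc c) a (shiftT 0 L) M)
    (cong (λ L' → ssubst a L' (shiftT (suc c) M)) (shiftT-shiftT L z≤n)))
  shiftT-ssubst c a L (app M P) = cong₂ app (shiftT-ssubst c a L M) (shiftT-ssubst c a L P)
  shiftT-ssubst c a L (mu C)    = cong mu (trans (shiftTC-ssubstC c (suc a) (shiftN 0 L) C)
    (cong (λ L' → ssubstC (suc a) L' (shiftTC c C)) (shiftT-shiftN c 0 L)))

  shiftTC-ssubstC : ∀ c a L C → shiftTC c (ssubstC a L C) ≡ ssubstC a (shiftT c L) (shiftTC c C)
  shiftTC-ssubstC c a L (named b P) with b ≟ a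
  ... | yes refl = begin
    shiftTC c (ssubstC b L (named b P))                ≡⟨ cong (shiftTC c) (ssubstC-≡ b L P) ⟩
    named b (app (shiftT c (ssubst b L P)) (shiftT c L)) ≡⟨ cong (λ P' → named b (app P' (shiftT c L))) (shiftT-ssubst c b L P) ⟩
    named b (app (ssubst b (shiftT c L) (shiftT c P)) (shiftT c L)) ≡⟨ sym (ssubstC-≡ b (shiftT c L) (shiftT c P)) ⟩
    ssubstC b (shiftT c L) (named b (shiftT c P))      ∎
  ... | no b≢a = begin
    shiftTC c (ssubstC a L (named b P))                ≡⟨ cong (shiftTC c) (ssubstC-≢ L P b≢a) ⟩
    named b (shiftT c (ssubst a L P))                  ≡⟨ cong (named b) (shiftT-ssubst c a L P) ⟩
    named b (ssubst a (shiftT c L) (shiftT c P))       ≡⟨ sym (ssubstC-≢ (shiftT c L) (shiftT c P) b≢a) ⟩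
    ssubstC a (shiftT c L) (named b (shiftT c P))      ∎

mutual
  shiftN-ssubst : ∀ c a L M → shiftN c (ssubst a L M) ≡ ssubst (shiftIdx c a) (shiftN c L) (shiftN c M)
  shiftN-ssubst c a L (var n)   = refl
  shiftN-ssubst c a L (lam M)   = cong lam (trans (shiftN-ssubst c a (shiftT 0 L) M)
    (cong (λ L' → ssubst (shiftIdx c a) L' (shiftN c M)) (sym (shiftT-shiftN 0 c L))))
  shiftN-ssubst c a L (app M P) = cong₂ app (shiftN-ssubst c a L M) (shiftN-ssubst c a L P)
  shiftN-ssubst c a L (mu C)    = cong mu (trans (shiftNC-ssubstC (suc c) (suc a) (shiftN 0 L) C)
    (cong₂ (λ a' L' → ssubstC a' L' (shiftNC (suc c) C)) (shiftIdx-suc c a) (shiftN-shiftN L z≤n)))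

  shiftNC-ssubstC : ∀ c a L C → shiftNC c (ssubstC a L C) ≡ ssubstC (shiftIdx c a) (shiftN c L) (shiftNC c C)
  shiftNC-ssubstC c a L (named b P) with b ≟ a
  ... | yes refl = begin
    shiftNC c (ssubstC b L (named b P))                ≡⟨ cong (shiftNC c) (ssubstC-≡ b L P) ⟩
    named b' (app (shiftN c (ssubst b L P)) (shiftN c L)) ≡⟨ cong (λ P' → named b' (app P' (shiftN c L))) (shiftN-ssubst c b L P) ⟩
    named b' (app (ssubst b' (shiftN c L) (shiftN c P)) (shiftN c L)) ≡⟨ sym (ssubstC-≡ b' (shiftN c L) (shiftN c P)) ⟩
    ssubstC b' (shiftN c L) (named b' (shiftN c P))    ∎
    where b' = shiftIdx c b
  ... | no b≢a = begin
    shiftNC c (ssubstC a L (named b P))                ≡⟨ cong (shiftNC c) (ssubstC-≢ L P b≢a) ⟩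
    named b' (shiftN c (ssubst a L P))                 ≡⟨ cong (named b') (shiftN-ssubst c a L P) ⟩
    named b' (ssubst (shiftIdx c a) (shiftN c L) (shiftN c P)) ≡⟨ sym (ssubstC-≢ (shiftN c L) (shiftN c P) (b≢a ∘ shiftIdx-injective c)) ⟩
    ssubstC (shiftIdx c a) (shiftN c L) (named b' (shiftN c P)) ∎
    where b' = shiftIdx c b

mutual
  ssubst-shiftN : ∀ c L M → ssubst c L (shiftN c M) ≡ shiftN c M
  ssubst-shiftN c L (var n)   = refl
  ssubst-shiftN c L (lam M)   = cong lam (ssubst-shiftN c (shiftT 0 L) M)
  ssubst-shiftN c L (app M P) = cong₂ app (ssubst-shiftN c L M) (ssubst-shiftN c L P)
  ssubst-shiftN c L (mu C)    = cong mu (ssubstC-shiftNC (suc c) (shiftN 0 L) C)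

  ssubstC-shiftNC : ∀ c L C → ssubstC c L (shiftNC c C) ≡ shiftNC c C
  ssubstC-shiftNC c L (named b P) =
    trans (ssubstC-≢ L (shiftN c P) (shiftIdx≢ c b)) (cong (named (shiftIdx c b)) (ssubst-shiftN c L P))

substT-substT-var> : ∀ {j k} N P m → j ≤ k → j ≤ m →
  substT k N (var m) ≡ substT j (substT k N P) (substVar (suc k) (shiftT j N) (suc m))
substT-substT-var> {j} {k} N P m j≤k j≤m with <-cmp m k
... | tri< m<k _ _ = begin
  substVar k N m                                                   ≡⟨ substVar-< N m<k ⟩
  var m                                                            ≡⟨ sym (substVar-> (substT k N P) (s≤s j≤m)) ⟩
  substT j (substT k N P) (var (suc m))                            ≡⟨ cong (substT j (substT k N P)) (sym (substVar-< (shiftT j N) (s≤s m<k))) ⟩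
  substT j (substT k N P) (substVar (suc k) (shiftT j N) (suc m))  ∎
... | tri≈ _ refl _ = begin
  substVar m N m                                                   ≡⟨ substVar-≡ m N refl ⟩
  N                                                                ≡⟨ sym (substT-shiftT j (substT m N P) N) ⟩
  substT j (substT m N P) (shiftT j N)                             ≡⟨ cong (substT j (substT m N P)) (sym (substVar-≡ (suc m) (shiftT j N) refl)) ⟩
  substT j (substT m N P) (substVar (suc m) (shiftT j N) (suc m))  ∎
substT-substT-var> {j} {k} N P (suc m) j≤k j≤1+m | tri> _ _ k<1+m = begin
  substVar k N (suc m)                                             ≡⟨ substVar-> N k<1+m ⟩
  var m                                                            ≡⟨ sym (substVar-> (substT k N P) (s≤s (≤-trans j≤k (≤-pred k<1+m)))) ⟩
  substT j (substT k N P) (var (suc m))                            ≡⟨ cong (substT j (substT k N P)) (sym (substVar-> (shiftT j N) (s≤s k<1+m))) ⟩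
  substT j (substT k N P) (substVar (suc k) (shiftT j N) (suc (suc m))) ∎

mutual
  substT-substT : ∀ {j k} N P M → j ≤ k → substT k N (substT j P M) ≡ substT j (substT k N P) (substT (suc k) (shiftT j N) M)
  substT-substT {j} {k} N P (var n) j≤k with <-cmp n j
  ... | tri< n<j _ _ = begin
    substT k N (substVar j P n)                          ≡⟨ cong (substT k N) (substVar-< P n<j) ⟩
    substVar k N n                                       ≡⟨ substVar-< N (<-≤-trans n<j j≤k) ⟩
    var n                                                ≡⟨ sym (substVar-< (substT k N P) n<j) ⟩
    substT j (substT k N P) (var n)                      ≡⟨ cong (substT j (substT k N P)) (sym (substVar-< (shiftT j N) (<-≤-trans n<j (m≤n⇒m≤1+n j≤k)))) ⟩
    substT j (substT k N P) (substVar (suc k) (shiftT j N) n) ∎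
  ... | tri≈ _ refl _ = begin
    substT k N (substVar n P n)                          ≡⟨ cong (substT k N) (substVar-≡ n P refl) ⟩
    substT k N P                                         ≡⟨ sym (substVar-≡ n (substT k N P) refl) ⟩
    substT n (substT k N P) (var n)                      ≡⟨ cong (substT n (substT k N P)) (sym (substVar-< (shiftT n N) (s≤s j≤k))) ⟩
    substT n (substT k N P) (substVar (suc k) (shiftT n N) n) ∎
  substT-substT {j} {k} N P (var (suc m)) j≤k | tri> _ _ j<1+m =
    trans (cong (substT k N) (substVar-> P j<1+m)) (substT-substT-var> N P m j≤k (≤-pred j<1+m))
  substT-substT {j} {k} N P (lam M) j≤k = cong lam (trans (substT-substT (shiftT 0 N) (shiftT 0 P) M (s≤s j≤k))
    (cong₂ (λ P' N' → substT (suc j) P' (substT (suc (suc k)) N' M)) (sym (shiftT-substT-below N P z≤n)) (shiftT-shiftT N z≤n)))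
  substT-substT N P (app M Q) j≤k = cong₂ app (substT-substT N P M j≤k) (substT-substT N P Q j≤k)
  substT-substT {j} {k} N P (mu C) j≤k = cong mu (trans (substTC-substTC (shiftN 0 N) (shiftN 0 P) C j≤k)
    (cong₂ (λ P' N' → substTC j P' (substTC (suc k) N' C)) (sym (shiftN-substT 0 k N P)) (shiftT-shiftN j 0 N)))

  substTC-substTC : ∀ {j k} N P C → j ≤ k → substTC k N (substTC j P C) ≡ substTC j (substT k N P) (substTC (suc k) (shiftT j N) C)
  substTC-substTC N P (named a M) j≤k = cong (named a) (substT-substT N P M j≤k)

substVar-ssubst : ∀ k a N L n → substVar k (shiftN a N) n ≡ ssubst a L (substVar k (shiftN a N) n)
substVar-ssubst k a N L n with compare n k
... | less _ _    = refl
... | equal _     = sym (ssubst-shiftN a L N)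
... | greater _ _ = refl

mutual
  substT-ssubst : ∀ k a N L M →
    substT k (shiftN a N) (ssubst a L M) ≡ ssubst a (substT k (shiftN a N) L) (substT k (shiftN a N) M)
  substT-ssubst k a N L (var n)   = substVar-ssubst k a N (substT k (shiftN a N) L) n
  substT-ssubst k a N L (lam M)   = cong lam (begin
    substT (suc k) (shiftT 0 (shiftN a N)) (ssubst a (shiftT 0 L) M)
      ≡⟨ cong (λ N' → substT (suc k) N' (ssubst a (shiftT 0 L) M)) (shiftT-shiftN 0 a N) ⟩
    substT (suc k) (shiftN a (shiftT 0 N)) (ssubst a (shiftT 0 L) M)
      ≡⟨ substT-ssubst (suc k) a (shiftT 0 N) (shiftT 0 L) M ⟩
    ssubst a (substT (suc k) (shiftN a (shiftT 0 N)) (shiftT 0 L)) (substT (suc k) (shiftN a (shiftT 0 N)) M)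
      ≡⟨ cong (λ N' → ssubst a (substT (suc k) N' (shiftT 0 L)) (substT (suc k) N' M)) (sym (shiftT-shiftN 0 a N)) ⟩
    ssubst a (substT (suc k) (shiftT 0 (shiftN a N)) (shiftT 0 L)) (substT (suc k) (shiftT 0 (shiftN a N)) M)
      ≡⟨ cong (λ L' → ssubst a L' (substT (suc k) (shiftT 0 (shiftN a N)) M)) (sym (shiftT-substT-below (shiftN a N) L z≤n)) ⟩
    ssubst a (shiftT 0 (substT k (shiftN a N) L)) (substT (suc k) (shiftT 0 (shiftN a N)) M) ∎)
  substT-ssubst k a N L (app M P) = cong₂ app (substT-ssubst k a N L M) (substT-ssubst k a N L P)
  substT-ssubst k a N L (mu C)    = cong mu (begin
    substTC k (shiftN 0 (shiftN a N)) (ssubstC (suc a) (shiftN 0 L) C)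
      ≡⟨ cong (λ N' → substTC k N' (ssubstC (suc a) (shiftN 0 L) C)) (sym (shiftN-shiftN N z≤n)) ⟩
    substTC k (shiftN (suc a) (shiftN 0 N)) (ssubstC (suc a) (shiftN 0 L) C)
      ≡⟨ substTC-ssubstC k (suc a) (shiftN 0 N) (shiftN 0 L) C ⟩
    ssubstC (suc a) (substT k (shiftN (suc a) (shiftN 0 N)) (shiftN 0 L)) (substTC k (shiftN (suc a) (shiftN 0 N)) C)
      ≡⟨ cong (λ N' → ssubstC (suc a) (substT k N' (shiftN 0 L)) (substTC k N' C)) (shiftN-shiftN N z≤n) ⟩
    ssubstC (suc a) (substT k (shiftN 0 (shiftN a N)) (shiftN 0 L)) (substTC k (shiftN 0 (shiftN a N)) C)
      ≡⟨ cong (λ L' → ssubstC (suc a) L' (substTC k (shiftN 0 (shiftN a N)) C)) (sym (shiftN-substT 0 k (shiftN a N) L)) ⟩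
    ssubstC (suc a) (shiftN 0 (substT k (shiftN a N) L)) (substTC k (shiftN 0 (shiftN a N)) C) ∎)

  substTC-ssubstC : ∀ k a N L C →
    substTC k (shiftN a N) (ssubstC a L C) ≡ ssubstC a (substT k (shiftN a N) L) (substTC k (shiftN a N) C)
  substTC-ssubstC k a N L (named b P) with b ≟ a
  ... | yes refl = trans (cong (substTC k (shiftN b N)) (ssubstC-≡ b L P))
    (trans (cong (λ P' → named b (app P' (substT k (shiftN b N) L))) (substT-ssubst k b N L P)) (sym (ssubstC-≡ b _ _)))
  ... | no b≢a = trans (cong (substTC k (shiftN a N)) (ssubstC-≢ L P b≢a))
    (trans (cong (named b) (substT-ssubst k a N L P)) (sym (ssubstC-≢ _ _ b≢a)))

mutual
  ssubst-ssubst : ∀ {a b} L N M → a ≢ b →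
    ssubst a (shiftN b L) (ssubst b N M) ≡ ssubst b (ssubst a (shiftN b L) N) (ssubst a (shiftN b L) M)
  ssubst-ssubst L N (var n) a≢b = refl
  ssubst-ssubst {a} {b} L N (lam M) a≢b = cong lam (begin
    ssubst a (shiftT 0 (shiftN b L)) (ssubst b (shiftT 0 N) M)
      ≡⟨ cong (λ L' → ssubst a L' (ssubst b (shiftT 0 N) M)) (shiftT-shiftN 0 b L) ⟩
    ssubst a (shiftN b (shiftT 0 L)) (ssubst b (shiftT 0 N) M)
      ≡⟨ ssubst-ssubst (shiftT 0 L) (shiftT 0 N) M a≢b ⟩
    ssubst b (ssubst a (shiftN b (shiftT 0 L)) (shiftT 0 N)) (ssubst a (shiftN b (shiftT 0 L)) M)
      ≡⟨ cong (λ L' → ssubst b (ssubst a L' (shiftT 0 N)) (ssubst a L' M)) (sym (shiftT-shiftN 0 b L)) ⟩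
    ssubst b (ssubst a (shiftT 0 (shiftN b L)) (shiftT 0 N)) (ssubst a (shiftT 0 (shiftN b L)) M)
      ≡⟨ cong (λ N' → ssubst b N' (ssubst a (shiftT 0 (shiftN b L)) M)) (sym (shiftT-ssubst 0 a (shiftN b L) N)) ⟩
    ssubst b (shiftT 0 (ssubst a (shiftN b L) N)) (ssubst a (shiftT 0 (shiftN b L)) M) ∎)
  ssubst-ssubst L N (app M P) a≢b = cong₂ app (ssubst-ssubst L N M a≢b) (ssubst-ssubst L N P a≢b)
  ssubst-ssubst {a} {b} L N (mu C) a≢b = cong mu (begin
    ssubstC (suc a) (shiftN 0 (shiftN b L)) (ssubstC (suc b) (shiftN 0 N) C)
      ≡⟨ cong (λ L' → ssubstC (suc a) L' (ssubstC (suc b) (shiftN 0 N) C)) (sym (shiftN-shiftN L z≤n)) ⟩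
    ssubstC (suc a) (shiftN (suc b) (shiftN 0 L)) (ssubstC (suc b) (shiftN 0 N) C)
      ≡⟨ ssubstC-ssubstC (shiftN 0 L) (shiftN 0 N) C (a≢b ∘ suc-injective) ⟩
    ssubstC (suc b) (ssubst (suc a) (shiftN (suc b) (shiftN 0 L)) (shiftN 0 N)) (ssubstC (suc a) (shiftN (suc b) (shiftN 0 L)) C)
      ≡⟨ cong (λ L' → ssubstC (suc b) (ssubst (suc a) L' (shiftN 0 N)) (ssubstC (suc a) L' C)) (shiftN-shiftN L z≤n) ⟩
    ssubstC (suc b) (ssubst (suc a) (shiftN 0 (shiftN b L)) (shiftN 0 N)) (ssubstC (suc a) (shiftN 0 (shiftN b L)) C)
      ≡⟨ cong (λ N' → ssubstC (suc b) N' (ssubstC (suc a) (shiftN 0 (shiftN b L)) C)) (sym (shiftN-ssubst 0 a (shiftN b L) N)) ⟩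
    ssubstC (suc b) (shiftN 0 (ssubst a (shiftN b L) N)) (ssubstC (suc a) (shiftN 0 (shiftN b L)) C) ∎)

  ssubstC-ssubstC : ∀ {a b} L N C → a ≢ b →
    ssubstC a (shiftN b L) (ssubstC b N C) ≡ ssubstC b (ssubst a (shiftN b L) N) (ssubstC a (shiftN b L) C)
  ssubstC-ssubstC {a} {b} L N (named c P) a≢b with c ≟ b | c ≟ a
  ... | yes refl | yes refl = ⊥-elim (a≢b refl)
  ... | yes refl | no c≢a = begin
    ssubstC a L' (ssubstC c N (named c P))                 ≡⟨ cong (ssubstC a L') (ssubstC-≡ c N P) ⟩
    ssubstC a L' (named c (app (ssubst c N P) N))          ≡⟨ ssubstC-≢ L' _ c≢a ⟩
    named c (app (ssubst a L' (ssubst c N P)) N')          ≡⟨ cong (λ Q → named c (app Q N')) (ssubst-ssubst L N P a≢b) ⟩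
    named c (app (ssubst c N' (ssubst a L' P)) N')         ≡⟨ sym (ssubstC-≡ c N' _) ⟩
    ssubstC c N' (named c (ssubst a L' P))                 ≡⟨ cong (ssubstC c N') (sym (ssubstC-≢ L' P c≢a)) ⟩
    ssubstC c N' (ssubstC a L' (named c P))                ∎
    where L' = shiftN c L
          N' = ssubst a L' N
  ... | no c≢b | yes refl = begin
    ssubstC c L' (ssubstC b N (named c P))                 ≡⟨ cong (ssubstC c L') (ssubstC-≢ N P c≢b) ⟩
    ssubstC c L' (named c (ssubst b N P))                  ≡⟨ ssubstC-≡ c L' _ ⟩
    named c (app (ssubst c L' (ssubst b N P)) L')          ≡⟨ cong₂ (λ Q R → named c (app Q R)) (ssubst-ssubst L N P a≢b) (sym (ssubst-shiftN b N' L)) ⟩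
    named c (app (ssubst b N' (ssubst c L' P)) (ssubst b N' L')) ≡⟨ sym (ssubstC-≢ N' _ c≢b) ⟩
    ssubstC b N' (named c (app (ssubst c L' P) L'))        ≡⟨ cong (ssubstC b N') (sym (ssubstC-≡ c L' P)) ⟩
    ssubstC b N' (ssubstC c L' (named c P))                ∎
    where L' = shiftN b L
          N' = ssubst c L' N
  ... | no c≢b | no c≢a = begin
    ssubstC a L' (ssubstC b N (named c P))                 ≡⟨ cong (ssubstC a L') (ssubstC-≢ N P c≢b) ⟩
    ssubstC a L' (named c (ssubst b N P))                  ≡⟨ ssubstC-≢ L' _ c≢a ⟩
    named c (ssubst a L' (ssubst b N P))                   ≡⟨ cong (named c) (ssubst-ssubst L N P a≢b) ⟩
    named c (ssubst b N' (ssubst a L' P))                  ≡⟨ sym (ssubstC-≢ N' _ c≢b) ⟩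
    ssubstC b N' (named c (ssubst a L' P))                 ≡⟨ cong (ssubstC b N') (sym (ssubstC-≢ L' P c≢a)) ⟩
    ssubstC b N' (ssubstC a L' (named c P))                ∎
    where L' = shiftN b L
          N' = ssubst a L' N

ssubst-substVar : ∀ a L k N n → ssubst a L (substVar k N n) ≡ substVar k (ssubst a L N) n
ssubst-substVar a L k N n with compare n k
... | less _ _    = refl
... | equal _     = refl
... | greater _ _ = refl

mutual
  ssubst-substT : ∀ a L k N M → ssubst a L (substT k N M) ≡ substT k (ssubst a L N) (ssubst a (shiftT k L) M)
  ssubst-substT a L k N (var n)   = ssubst-substVar a L k N n
  ssubst-substT a L k N (lam M)   = cong lam (trans (ssubst-substT a (shiftT 0 L) (suc k) (shiftT 0 N) M)
    (cong₂ (λ N' L' → substT (suc k) N' (ssubst a L' M)) (sym (shiftT-ssubst 0 a L N)) (shiftT-shiftT L z≤n)))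
  ssubst-substT a L k N (app M P) = cong₂ app (ssubst-substT a L k N M) (ssubst-substT a L k N P)
  ssubst-substT a L k N (mu C)    = cong mu (trans (ssubstC-substTC (suc a) (shiftN 0 L) k (shiftN 0 N) C)
    (cong₂ (λ N' L' → substTC k N' (ssubstC (suc a) L' C)) (sym (shiftN-ssubst 0 a L N)) (shiftT-shiftN k 0 L)))

  ssubstC-substTC : ∀ a L k N C → ssubstC a L (substTC k N C) ≡ substTC k (ssubst a L N) (ssubstC a (shiftT k L) C)
  ssubstC-substTC a L k N (named b P) with b ≟ a
  ... | yes refl = trans (ssubstC-≡ b L _)
    (trans (cong₂ (λ P' L' → named b (app P' L')) (ssubst-substT b L k N P) (sym (substT-shiftT k _ L)))
      (cong (substTC k (ssubst b L N)) (sym (ssubstC-≡ b (shiftT k L) P))))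
  ... | no b≢a = trans (ssubstC-≢ L _ b≢a) (trans (cong (named b) (ssubst-substT a L k N P))
    (cong (substTC k (ssubst a L N)) (sym (ssubstC-≢ (shiftT k L) P b≢a))))

-- Reduction is stable under shifts and substitutions

_⟶*_ : Term → Term → Set
_⟶*_ = Star _⟶_

_⟶ᶜ*_ : Cmd → Cmd → Set
_⟶ᶜ*_ = Star _⟶ᶜ_

shiftT-⟶ : ∀ c {M M'} → M ⟶ M' → shiftT c M ⟶ shiftT c M'
shiftT-⟶ c (βstep {M} {N}) = subst (shiftT c (app (lam M) N) ⟶_) (sym (shiftT-substT-above N M z≤n)) βstep
shiftT-⟶ c (μstep {C} {N}) = subst (shiftT c (app (mu C) N) ⟶_)
  (sym (cong mu (trans (shiftTC-ssubstC c 0 (shiftN 0 N) C) (cong (λ N' → ssubstC 0 N' (shiftTC c C)) (shiftT-shiftN c 0 N))))) μstep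
shiftT-⟶ c (lamc s)          = lamc (shiftT-⟶ (suc c) s)
shiftT-⟶ c (appl s)          = appl (shiftT-⟶ c s)
shiftT-⟶ c (appr s)          = appr (shiftT-⟶ c s)
shiftT-⟶ c (muc (namedc s))  = muc (namedc (shiftT-⟶ c s))

shiftN-⟶ : ∀ c {M M'} → M ⟶ M' → shiftN c M ⟶ shiftN c M'
shiftN-⟶ c (βstep {M} {N}) = subst (shiftN c (app (lam M) N) ⟶_) (sym (shiftN-substT c 0 N M)) βstep
shiftN-⟶ c (μstep {C} {N}) = subst (shiftN c (app (mu C) N) ⟶_)
  (sym (cong mu (trans (shiftNC-ssubstC (suc c) 0 (shiftN 0 N) C) (cong (λ N' → ssubstC 0 N' (shiftNC (suc c) C)) (shiftN-shiftN N z≤n))))) μstep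
shiftN-⟶ c (lamc s)          = lamc (shiftN-⟶ c s)
shiftN-⟶ c (appl s)          = appl (shiftN-⟶ c s)
shiftN-⟶ c (appr s)          = appr (shiftN-⟶ c s)
shiftN-⟶ c (muc (namedc s))  = muc (namedc (shiftN-⟶ (suc c) s))

substT-⟶ : ∀ k N {M M'} → M ⟶ M' → substT k N M ⟶ substT k N M'
substT-⟶ k N (βstep {M} {P}) = subst (substT k N (app (lam M) P) ⟶_) (sym (substT-substT N P M z≤n)) βstep
substT-⟶ k N (μstep {C} {P}) = subst (substT k N (app (mu C) P) ⟶_)
  (sym (cong mu (trans (substTC-ssubstC k 0 N (shiftN 0 P) C)
    (cong (λ P' → ssubstC 0 P' (substTC k (shiftN 0 N) C)) (sym (shiftN-substT 0 k N P)))))) μstep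
substT-⟶ k N (lamc s)          = lamc (substT-⟶ (suc k) (shiftT 0 N) s)
substT-⟶ k N (appl s)          = appl (substT-⟶ k N s)
substT-⟶ k N (appr s)          = appr (substT-⟶ k N s)
substT-⟶ k N (muc (namedc s))  = muc (namedc (substT-⟶ k (shiftN 0 N) s))

mutual
  ssubst-⟶ : ∀ a L {M M'} → M ⟶ M' → ssubst a L M ⟶ ssubst a L M'
  ssubst-⟶ a L (βstep {M} {N}) = subst (ssubst a L (app (lam M) N) ⟶_) (sym (ssubst-substT a L 0 N M)) βstep
  ssubst-⟶ a L (μstep {C} {N}) = subst (ssubst a L (app (mu C) N) ⟶_)
    (sym (cong mu (trans (ssubstC-ssubstC {suc a} {0} L (shiftN 0 N) C (λ ()))
      (cong (λ N' → ssubstC 0 N' (ssubstC (suc a) (shiftN 0 L) C)) (sym (shiftN-ssubst 0 a L N)))))) μstep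
  ssubst-⟶ a L (lamc s) = lamc (ssubst-⟶ a (shiftT 0 L) s)
  ssubst-⟶ a L (appl s) = appl (ssubst-⟶ a L s)
  ssubst-⟶ a L (appr s) = appr (ssubst-⟶ a L s)
  ssubst-⟶ a L (muc s)  = muc (ssubstC-⟶ᶜ (suc a) (shiftN 0 L) s)

  ssubstC-⟶ᶜ : ∀ a L {C C'} → C ⟶ᶜ C' → ssubstC a L C ⟶ᶜ ssubstC a L C'
  ssubstC-⟶ᶜ a L (namedc {b} {P} {P'} s) with b ≟ a
  ... | yes refl = subst₂ _⟶ᶜ_ (sym (ssubstC-≡ b L P)) (sym (ssubstC-≡ b L P')) (namedc (appl (ssubst-⟶ b L s)))
  ... | no b≢a   = subst₂ _⟶ᶜ_ (sym (ssubstC-≢ L P b≢a)) (sym (ssubstC-≢ L P' b≢a)) (namedc (ssubst-⟶ a L s))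

mutual
  ssubst-arg-⟶* : ∀ a {L L'} → L ⟶ L' → ∀ M → ssubst a L M ⟶* ssubst a L' M
  ssubst-arg-⟶* a s (var n)   = ε
  ssubst-arg-⟶* a s (lam M)   = gmap lam lamc (ssubst-arg-⟶* a (shiftT-⟶ 0 s) M)
  ssubst-arg-⟶* a {L} {L'} s (app M P) =
    gmap (λ M' → app M' (ssubst a L P)) appl (ssubst-arg-⟶* a s M) ◅◅ gmap (app (ssubst a L' M)) appr (ssubst-arg-⟶* a s P)
  ssubst-arg-⟶* a s (mu C)    = gmap mu muc (ssubstC-arg-⟶ᶜ* (suc a) (shiftN-⟶ 0 s) C)

  ssubstC-arg-⟶ᶜ* : ∀ a {L L'} → L ⟶ L' → ∀ C → ssubstC a L C ⟶ᶜ* ssubstC a L' C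
  ssubstC-arg-⟶ᶜ* a {L} {L'} s (named b P) with b ≟ a
  ... | yes refl = subst₂ _⟶ᶜ*_ (sym (ssubstC-≡ b L P)) (sym (ssubstC-≡ b L' P))
    (gmap (named b) namedc (gmap (λ P' → app P' L) appl (ssubst-arg-⟶* b s P) ◅◅ (appr s ◅ ε)))
  ... | no b≢a   = subst₂ _⟶ᶜ*_ (sym (ssubstC-≢ L P b≢a)) (sym (ssubstC-≢ L' P b≢a))
    (gmap (named b) namedc (ssubst-arg-⟶* a s P))

substVar-arg-⟶* : ∀ k {N N'} → N ⟶ N' → ∀ n → substVar k N n ⟶* substVar k N' n
substVar-arg-⟶* k s n with compare n k
... | less _ _    = ε
... | equal _     = s ◅ ε
... | greater _ _ = ε

substT-arg-⟶* : ∀ k {N N'} → N ⟶ N' → ∀ M → substT k N M ⟶* substT k N' M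
substT-arg-⟶* k s (var n)   = substVar-arg-⟶* k s n
substT-arg-⟶* k s (lam M)   = gmap lam lamc (substT-arg-⟶* (suc k) (shiftT-⟶ 0 s) M)
substT-arg-⟶* k {N} {N'} s (app M P) =
  gmap (λ M' → app M' (substT k N P)) appl (substT-arg-⟶* k s M) ◅◅ gmap (app (substT k N' M)) appr (substT-arg-⟶* k s P)
substT-arg-⟶* k s (mu (named a M)) = gmap (λ M' → mu (named a M')) (muc ∘ namedc) (substT-arg-⟶* k (shiftN-⟶ 0 s) M)

SN-⟶* : ∀ {M M'} → SN M → M ⟶* M' → SN M'
SN-⟶* M∈SN       ε        = M∈SN
SN-⟶* (sn M∈SN) (s ◅ ss) = SN-⟶* (M∈SN s) ss

SN-reflect : ∀ (f : Term → Term) → (∀ {M M'} → M ⟶ M' → f M ⟶ f M') → ∀ {M} → SN (f M) → SN M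
SN-reflect f f-⟶ (sn fM∈SN) = sn (λ s → SN-reflect f f-⟶ (fM∈SN (f-⟶ s)))

·*-++ : ∀ X Ps Ls → X ·* (Ps ++ Ls) ≡ (X ·* Ps) ·* Ls
·*-++ = foldl-++ app

·*-⟶ : ∀ Ls {X X'} → X ⟶ X' → (X ·* Ls) ⟶ (X' ·* Ls)
·*-⟶ []       s = s
·*-⟶ (L ∷ Ls) s = ·*-⟶ Ls (appl s)

·*-⟶* : ∀ Ls {X X'} → X ⟶* X' → (X ·* Ls) ⟶* (X' ·* Ls)
·*-⟶* Ls = gmap (_·* Ls) (·*-⟶ Ls)

data _⟶ˢ_ : Stack → Stack → Set where
  here  : ∀ {L L' Ls} → L ⟶ L' → (L ∷ Ls) ⟶ˢ (L' ∷ Ls)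
  there : ∀ {L Ls Ls'} → Ls ⟶ˢ Ls' → (L ∷ Ls) ⟶ˢ (L ∷ Ls')

·*-⟶ˢ : ∀ X {Ls Ls'} → Ls ⟶ˢ Ls' → (X ·* Ls) ⟶ (X ·* Ls')
·*-⟶ˢ X (here {Ls = Ls} s) = ·*-⟶ Ls (appr s)
·*-⟶ˢ X (there {L} t)      = ·*-⟶ˢ (app X L) t

length-⟶ˢ : ∀ {Ls Ls'} → Ls ⟶ˢ Ls' → length Ls ≡ length Ls'
length-⟶ˢ (here s)  = refl
length-⟶ˢ (there t) = cong suc (length-⟶ˢ t)

app·*-⟶-inv : ∀ A B Ps {R} → (app A B ·* Ps) ⟶ R →
  (∃ λ R' → app A B ⟶ R' × R ≡ R' ·* Ps) ⊎ (∃ λ Ps' → Ps ⟶ˢ Ps' × R ≡ app A B ·* Ps')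
app·*-⟶-inv A B []       s = inj₁ (_ , s , refl)
app·*-⟶-inv A B (P ∷ Ps) s with app·*-⟶-inv (app A B) P Ps s
... | inj₂ (Ps' , t , eq)     = inj₂ (P ∷ Ps' , there t , eq)
... | inj₁ (_ , appl s' , eq) = inj₁ (_ , s' , eq)
... | inj₁ (_ , appr s' , eq) = inj₂ (_ ∷ Ps , here s' , eq)

++-⟶ˢ-inv : ∀ Ns {Ps Qs} → (Ns ++ Ps) ⟶ˢ Qs →
  (∃ λ Ns' → Ns ⟶ˢ Ns' × Qs ≡ Ns' ++ Ps) ⊎ (∃ λ Ps' → Ps ⟶ˢ Ps' × Qs ≡ Ns ++ Ps')
++-⟶ˢ-inv []       t         = inj₂ (_ , t , refl)
++-⟶ˢ-inv (N ∷ Ns) (here s)  = inj₁ (_ ∷ Ns , here s , refl)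
++-⟶ˢ-inv (N ∷ Ns) (there t) with ++-⟶ˢ-inv Ns t
... | inj₁ (Ns' , t' , eq) = inj₁ (N ∷ Ns' , there t' , cong (N ∷_) eq)
... | inj₂ (Ps' , t' , eq) = inj₂ (Ps' , t' , cong (N ∷_) eq)

SN-·*⇒SN* : ∀ X Ls → SN (X ·* Ls) → SN* Ls
SN-·*⇒SN* X []       _ = []
SN-·*⇒SN* X (L ∷ Ls) h = SN-reflect (app X) appr (SN-reflect (_·* Ls) (·*-⟶ Ls) h) ∷ SN-·*⇒SN* (app X L) Ls h

SN*-unshiftN : ∀ Ns → SN* (shiftN* Ns) → SN* Ns
SN*-unshiftN []       []               = []
SN*-unshiftN (N ∷ Ns) (N∈SN ∷ Ns∈SN*) = SN-reflect (shiftN 0) (shiftN-⟶ 0) N∈SN ∷ SN*-unshiftN Ns Ns∈SN*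

SN-mu-named-·* : ∀ a Ps {X} → SN (mu (named a X) ·* Ps) → SN X
SN-mu-named-·* a Ps = SN-reflect (λ X → mu (named a X)) (muc ∘ namedc) ∘ SN-reflect (_·* Ps) (·*-⟶ Ps)

data VarHeaded : Term → Set where
  var : ∀ {n} → VarHeaded (var n)
  app : ∀ {H M} → VarHeaded H → VarHeaded (app H M)

VarHeaded-⟶ : ∀ {H H'} → VarHeaded H → H ⟶ H' → VarHeaded H'
VarHeaded-⟶ (app ()) βstep
VarHeaded-⟶ (app ()) μstep
VarHeaded-⟶ (app h) (appl s) = app (VarHeaded-⟶ h s)
VarHeaded-⟶ (app h) (appr s) = app h

mutual
  SN-app-VarHeaded : ∀ {H L} → VarHeaded H → SN H → SN L → SN (app H L)
  SN-app-VarHeaded h H∈SN L∈SN = sn (app-VarHeaded-reduct-SN h H∈SN L∈SN)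

  app-VarHeaded-reduct-SN : ∀ {H L R} → VarHeaded H → SN H → SN L → app H L ⟶ R → SN R
  app-VarHeaded-reduct-SN ()  _            _            βstep
  app-VarHeaded-reduct-SN ()  _            _            μstep
  app-VarHeaded-reduct-SN h   (sn H-steps) L∈SN         (appl s) = SN-app-VarHeaded (VarHeaded-⟶ h s) (H-steps s) L∈SN
  app-VarHeaded-reduct-SN h   H∈SN         (sn L-steps) (appr s) = SN-app-VarHeaded h H∈SN (L-steps s)

SN-VarHeaded-·* : ∀ {H} Ls → VarHeaded H → SN H → SN* Ls → SN (H ·* Ls)
SN-VarHeaded-·* []       h H∈SN []              = H∈SN
SN-VarHeaded-·* (L ∷ Ls) h H∈SN (L∈SN ∷ Ls∈SN*) = SN-VarHeaded-·* Ls (app h) (SN-app-VarHeaded h H∈SN L∈SN) Ls∈SN*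

SN-var-·* : ∀ n Ls → SN* Ls → SN (var n ·* Ls)
SN-var-·* n Ls = SN-VarHeaded-·* Ls var (sn λ ())

-- Head expansion

SN-Expansion : Term → Term → Set
SN-Expansion A B = ∀ Ls → SN (A ·* Ls) → SN (B ·* Ls)

SN-Expansion-·* : ∀ {A B} Ps → SN-Expansion A B → SN-Expansion (A ·* Ps) (B ·* Ps)
SN-Expansion-·* {A} {B} Ps A⇝B Ls h = subst SN (·*-++ B Ps Ls) (A⇝B (Ps ++ Ls) (subst SN (sym (·*-++ A Ps Ls)) h))

mutual
  SN-β-expansion : ∀ {M N} → SN N → SN-Expansion (M [ N /0]) (app (lam M) N)
  SN-β-expansion N∈SN Ps h = sn (β-reduct-SN Ps N∈SN h)

  β-reduct-SN : ∀ {M N R} Ps → SN N → SN ((M [ N /0]) ·* Ps) → (app (lam M) N ·* Ps) ⟶ R → SN R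
  β-reduct-SN {M} {N} Ps N∈SN h s with app·*-⟶-inv (lam M) N Ps s
  ... | inj₁ (_ , βstep , refl) = h
  β-reduct-SN {N = N} Ps N∈SN (sn h-steps) _ | inj₁ (_ , appl (lamc t) , refl) =
    SN-β-expansion N∈SN Ps (h-steps (·*-⟶ Ps (substT-⟶ 0 N t)))
  β-reduct-SN {M} Ps (sn N-steps) h _ | inj₁ (_ , appr t , refl) =
    SN-β-expansion (N-steps t) Ps (SN-⟶* h (·*-⟶* Ps (substT-arg-⟶* 0 t M)))
  β-reduct-SN Ps N∈SN (sn h-steps) _ | inj₂ (Ps' , t , refl) =
    SN-β-expansion N∈SN Ps' (h-steps (·*-⟶ˢ _ t))

ssubstC*-⟶ᶜ : ∀ a Ls {C C'} → C ⟶ᶜ C' → ssubstC* a Ls C ⟶ᶜ ssubstC* a Ls C'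
ssubstC*-⟶ᶜ a []       s = s
ssubstC*-⟶ᶜ a (L ∷ Ls) s = ssubstC*-⟶ᶜ a Ls (ssubstC-⟶ᶜ a L s)

ssubstC*-⟶ˢ : ∀ a C {Ls Ls'} → Ls ⟶ˢ Ls' → ssubstC* a (shiftN* Ls) C ⟶ᶜ* ssubstC* a (shiftN* Ls') C
ssubstC*-⟶ˢ a C (here {Ls = Ls} s) =
  gmap (ssubstC* a (shiftN* Ls)) (ssubstC*-⟶ᶜ a (shiftN* Ls)) (ssubstC-arg-⟶ᶜ* a (shiftN-⟶ 0 s) C)
ssubstC*-⟶ˢ a C (there {L} t) = ssubstC*-⟶ˢ a (ssubstC a (shiftN 0 L) C) t

-- SN* Ns is carried as SN (var 0 ·* Ns): one accessibility proof covering every step inside the stack.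
-- The counter n = length Ns decreases exactly at the μ-steps, which consume the first stack element;
-- every other step decreases one of the two SN premises.
mutual
  μ-expansion : ∀ n C Ns Ps → length Ns ≡ n → SN (var 0 ·* Ns) →
    SN (mu (ssubstC* 0 (shiftN* Ns) C) ·* Ps) → SN (mu C ·* (Ns ++ Ps))
  μ-expansion n C []       Ps _   _  h = h
  μ-expansion n C (N ∷ Ns) Ps len stack∈SN h = sn (μ-reduct-SN n C N Ns Ps len stack∈SN h)

  μ-reduct-SN : ∀ n C N Ns Ps {R} → length (N ∷ Ns) ≡ n → SN (var 0 ·* (N ∷ Ns)) →
    SN (mu (ssubstC* 0 (shiftN* (N ∷ Ns)) C) ·* Ps) → (app (mu C) N ·* (Ns ++ Ps)) ⟶ R → SN R
  μ-reduct-SN n C N Ns Ps len stack∈SN h s with app·*-⟶-inv (mu C) N (Ns ++ Ps) s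
  μ-reduct-SN zero    C N Ns Ps () stack∈SN h _ | inj₁ (_ , μstep , refl)
  μ-reduct-SN (suc n) C N Ns Ps len stack∈SN h _ | inj₁ (_ , μstep , refl) =
    μ-expansion n (ssubstC 0 (shiftN 0 N) C) Ns Ps (suc-injective len)
      (SN-var-·* 0 Ns (All.tail (SN-·*⇒SN* (var 0) (N ∷ Ns) stack∈SN))) h
  μ-reduct-SN n C N Ns Ps len stack∈SN (sn h-steps) _ | inj₁ (_ , appl (muc t) , refl) =
    μ-expansion n _ (N ∷ Ns) Ps len stack∈SN
      (h-steps (·*-⟶ Ps (muc (ssubstC*-⟶ᶜ 0 (shiftN* Ns) (ssubstC-⟶ᶜ 0 (shiftN 0 N) t)))))
  μ-reduct-SN n C N Ns Ps len (sn stack-steps) h _ | inj₁ (_ , appr t , refl) =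
    μ-expansion n C (_ ∷ Ns) Ps len (stack-steps (·*-⟶ˢ (var 0) (here {Ls = Ns} t)))
      (SN-⟶* h (·*-⟶* Ps (gmap mu muc (ssubstC*-⟶ˢ 0 C (here {Ls = Ns} t)))))
  ... | inj₂ (_ , t , refl) with ++-⟶ˢ-inv Ns t
  μ-reduct-SN n C N Ns Ps len (sn stack-steps) h _ | inj₂ (_ , t , refl) | inj₁ (Ns' , t' , refl) =
    μ-expansion n C (N ∷ Ns') Ps (trans (cong suc (sym (length-⟶ˢ t'))) len) (stack-steps (·*-⟶ˢ (var 0) (there t')))
      (SN-⟶* h (·*-⟶* Ps (gmap mu muc (ssubstC*-⟶ˢ 0 C (there t')))))
  μ-reduct-SN n C N Ns Ps len stack∈SN (sn h-steps) _ | inj₂ (_ , t , refl) | inj₂ (Ps' , t' , refl) =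
    μ-expansion n C (N ∷ Ns) Ps' len stack∈SN (h-steps (·*-⟶ˢ _ t'))

SN-μ-expansion : ∀ {C Ns} → SN* Ns → SN-Expansion (mu (ssubstC* 0 (shiftN* Ns) C)) (mu C ·* Ns)
SN-μ-expansion {C} {Ns} Ns∈SN* Ps h =
  subst SN (·*-++ (mu C) Ns Ps) (μ-expansion _ C Ns Ps refl (SN-var-·* 0 Ns Ns∈SN*) h)

depth : SType → ℕ
depth (δ ×ω)    = 1
depth (δ ×ˢ κ)  = suc (depth κ)
depth (κ ∧ˢ κ') = depth κ + depth κ'

SN*-replicate-var : ∀ n m → SN* (replicate m (var n))
SN*-replicate-var n zero    = []
SN*-replicate-var n (suc m) = sn (λ ()) ∷ SN*-replicate-var n m

mutual
  ⟦⟧⊆SN : ∀ δ {M} → ⟦ δ ⟧ M → SN M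
  ⟦⟧⊆SN ν         M∈δ       = M∈δ
  ⟦⟧⊆SN ω⇒ν       M∈δ       = M∈δ
  ⟦⟧⊆SN (κ ⇒ν)    M∈δ       = SN-reflect (_·* vars) (·*-⟶ vars) (M∈δ vars (vars∈⟦⟧ˢ κ 0 0))
    where vars = replicate (depth κ + 0) (var 0)
  ⟦⟧⊆SN (δ ∧ᵗ δ') (M∈δ , _) = ⟦⟧⊆SN δ M∈δ

  ⟦⟧ˢ⊆SN* : ∀ κ {Ls} → ⟦ κ ⟧ˢ Ls → SN* Ls
  ⟦⟧ˢ⊆SN* (δ ×ω)    {N ∷ Ls} (N∈δ , Ls∈SN*) = ⟦⟧⊆SN δ N∈δ ∷ Ls∈SN*
  ⟦⟧ˢ⊆SN* (δ ×ˢ κ)  {N ∷ Ls} (N∈δ , Ls∈κ)   = ⟦⟧⊆SN δ N∈δ ∷ ⟦⟧ˢ⊆SN* κ Ls∈κ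
  ⟦⟧ˢ⊆SN* (κ ∧ˢ κ')          (Ls∈κ , _)     = ⟦⟧ˢ⊆SN* κ Ls∈κ

  var∈⟦⟧ : ∀ δ n → ⟦ δ ⟧ (var n)
  var∈⟦⟧ ν         n = sn (λ ())
  var∈⟦⟧ ω⇒ν       n = sn (λ ())
  var∈⟦⟧ (κ ⇒ν)    n = λ Ls Ls∈κ → SN-var-·* n Ls (⟦⟧ˢ⊆SN* κ Ls∈κ)
  var∈⟦⟧ (δ ∧ᵗ δ') n = var∈⟦⟧ δ n , var∈⟦⟧ δ' n

  vars∈⟦⟧ˢ : ∀ κ n m → ⟦ κ ⟧ˢ (replicate (depth κ + m) (var n))
  vars∈⟦⟧ˢ (δ ×ω)    n m = var∈⟦⟧ δ n , SN*-replicate-var n m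
  vars∈⟦⟧ˢ (δ ×ˢ κ)  n m = var∈⟦⟧ δ n , vars∈⟦⟧ˢ κ n m
  vars∈⟦⟧ˢ (κ ∧ˢ κ') n m =
    subst (λ k → ⟦ κ ⟧ˢ (replicate k (var n))) (sym (+-assoc (depth κ) (depth κ') m)) (vars∈⟦⟧ˢ κ n (depth κ' + m)) ,
    subst (λ k → ⟦ κ' ⟧ˢ (replicate k (var n)))
      (trans (sym (+-assoc (depth κ') (depth κ) m)) (cong (_+ m) (+-comm (depth κ') (depth κ)))) (vars∈⟦⟧ˢ κ' n (depth κ + m))

⟦⟧-SN-Expansion : ∀ δ {A B} → SN-Expansion A B → ⟦ δ ⟧ A → ⟦ δ ⟧ B
⟦⟧-SN-Expansion ν         A⇝B A∈δ          = A⇝B [] A∈δ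
⟦⟧-SN-Expansion ω⇒ν       A⇝B A∈δ          = A⇝B [] A∈δ
⟦⟧-SN-Expansion (κ ⇒ν)    A⇝B A∈δ          = λ Ls Ls∈κ → A⇝B Ls (A∈δ Ls Ls∈κ)
⟦⟧-SN-Expansion (δ ∧ᵗ δ') A⇝B (A∈δ , A∈δ') = ⟦⟧-SN-Expansion δ A⇝B A∈δ , ⟦⟧-SN-Expansion δ' A⇝B A∈δ'

⟦⟧-β-expansion : ∀ δ {M N} Ps → SN N → ⟦ δ ⟧ ((M [ N /0]) ·* Ps) → ⟦ δ ⟧ (app (lam M) N ·* Ps)
⟦⟧-β-expansion δ Ps N∈SN = ⟦⟧-SN-Expansion δ (SN-Expansion-·* Ps (SN-β-expansion N∈SN))

⟦⟧-μ-expansion : ∀ δ {C} Ns Ps → SN* Ns → ⟦ δ ⟧ (mu (ssubstC* 0 (shiftN* Ns) C) ·* Ps) → ⟦ δ ⟧ ((mu C ·* Ns) ·* Ps)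
⟦⟧-μ-expansion δ Ns Ps Ns∈SN* = ⟦⟧-SN-Expansion δ (SN-Expansion-·* Ps (SN-μ-expansion Ns∈SN*))

-- Structural substitution of a stack in which the name is fresh

ssubst-·* : ∀ a L X Qs → ssubst a L (X ·* Qs) ≡ ssubst a L X ·* map (ssubst a L) Qs
ssubst-·* a L X []       = refl
ssubst-·* a L X (Q ∷ Qs) = ssubst-·* a L (app X Q) Qs

ssubst-shiftN* : ∀ L Qs → map (ssubst 0 L) (shiftN* Qs) ≡ shiftN* Qs
ssubst-shiftN* L []       = refl
ssubst-shiftN* L (Q ∷ Qs) = cong₂ _∷_ (ssubst-shiftN 0 L Q) (ssubst-shiftN* L Qs)

ssubstC*-named-·* : ∀ Ns Qs X →
  ssubstC* 0 (shiftN* Ns) (named 0 (X ·* shiftN* Qs)) ≡ named 0 (ssubst* 0 (shiftN* Ns) X ·* shiftN* (Qs ++ Ns))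
ssubstC*-named-·* []       Qs X = cong (λ Qs' → named 0 (X ·* shiftN* Qs')) (sym (++-identityʳ Qs))
ssubstC*-named-·* (N ∷ Ns) Qs X = begin
  ssubstC* 0 (shiftN* Ns) (named 0 (app (ssubst 0 L (X ·* shiftN* Qs)) L))
    ≡⟨ cong (λ Y → ssubstC* 0 (shiftN* Ns) (named 0 (app Y L)))
            (trans (ssubst-·* 0 L X (shiftN* Qs)) (cong (ssubst 0 L X ·*_) (ssubst-shiftN* L Qs))) ⟩
  ssubstC* 0 (shiftN* Ns) (named 0 (app (ssubst 0 L X ·* shiftN* Qs) L))
    ≡⟨ cong (λ Y → ssubstC* 0 (shiftN* Ns) (named 0 Y))
            (trans (sym (·*-++ (ssubst 0 L X) (shiftN* Qs) [ L ])) (cong (ssubst 0 L X ·*_) (sym (map-++ (shiftN 0) Qs [ N ])))) ⟩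
  ssubstC* 0 (shiftN* Ns) (named 0 (ssubst 0 L X ·* shiftN* (Qs ++ [ N ])))
    ≡⟨ ssubstC*-named-·* Ns (Qs ++ [ N ]) (ssubst 0 L X) ⟩
  named 0 (ssubst* 0 (shiftN* Ns) (ssubst 0 L X) ·* shiftN* ((Qs ++ [ N ]) ++ Ns))
    ≡⟨ cong (λ Qs' → named 0 (ssubst* 0 (shiftN* Ns) (ssubst 0 L X) ·* shiftN* Qs')) (++-assoc Qs [ N ] Ns) ⟩
  named 0 (ssubst* 0 (shiftN* Ns) (ssubst 0 L X) ·* shiftN* (Qs ++ N ∷ Ns)) ∎
  where L = shiftN 0 N

lemma2p15 : (∀ (δ δ' : TType) (M N : Term) (Ps : Stack) →
    ⟦ δ ⟧ ((M [ N /0]) ·* Ps) → ⟦ δ' ⟧ N →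
    ⟦ δ ⟧ (app (lam M) N ·* Ps))
    ×
    (∀ (δ : TType) (κ : SType) (β : ℕ) (M : Term) (Ns Ps : Stack) →
    ⟦ δ ⟧ (mu (ssubstC* 0 (shiftN* Ns) (named β M)) ·* Ps) → ⟦ κ ⟧ˢ Ns →
    ⟦ δ ⟧ ((mu (named β M) ·* Ns) ·* Ps))
    ×
    (∀ (δ : TType) (M : Term) (Ns Ps : Stack) →
    ⟦ δ ⟧ (mu (named 0 (ssubst* 0 (shiftN* Ns) M ·* shiftN* Ns)) ·* Ps) →
    ⟦ δ ⟧ ((mu (named 0 M) ·* Ns) ·* Ps))
lemma2p15 =
  (λ δ δ' M N Ps h N∈δ' → ⟦⟧-β-expansion δ Ps (⟦⟧⊆SN δ' N∈δ') h) ,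
  (λ δ κ β M Ns Ps h Ns∈κ → ⟦⟧-μ-expansion δ Ns Ps (⟦⟧ˢ⊆SN* κ Ns∈κ) h) ,
  clause₃
  where
  clause₃ : ∀ δ M Ns Ps → ⟦ δ ⟧ (mu (named 0 (ssubst* 0 (shiftN* Ns) M ·* shiftN* Ns)) ·* Ps) →
    ⟦ δ ⟧ ((mu (named 0 M) ·* Ns) ·* Ps)
  clause₃ δ M Ns Ps h =
    ⟦⟧-μ-expansion δ Ns Ps Ns∈SN* (subst (λ C → ⟦ δ ⟧ (mu C ·* Ps)) (sym (ssubstC*-named-·* Ns [] M)) h)
    where
    Ns∈SN* : SN* Ns
    Ns∈SN* = SN*-unshiftN Ns (SN-·*⇒SN* _ (shiftN* Ns) (SN-mu-named-·* 0 Ps (⟦⟧⊆SN δ h)))
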